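{- Let $X$ be a super $X$-set parameter, let $G$ be a graph, and let $S_1$ and $S_2$ be $X$-sets of $G$ with $|S_1|=|S_2|=k$. Then there is a path between $S_1$ and $S_2$ in the $k$-TJ reconfiguration graph of $G$ for $X$ if and only if there is a path between $S_1$ and $S_2$ in $\mathfrak{X}_{k+1}(G)$.
   Context: All graphs are finite, simple, undirected, with nonempty vertex set. A vertex set property assigns to each graph $G$ a family of subsets of $V(G)$ (the $X$-sets of $G$), invariant under graph isomorphism; it is cohesive if every graph has at least one $X$-set. A super $X$-set parameter is a cohesive vertex set property such that if $S$ is an $X$-set of $G$ and $S\subseteq S'\subseteq V(G)$ then $S'$ is an $X$-set. The $X$-TAR graph $\mathfrak{X}(G)$ has as vertices the $X$-sets of $G$, with $S_1,S_2$ adjacent iff $|S_1\ominus S_2|=1$; $\mathfrak{X}_k(G)$ is its subgraph induced by the $X$-sets of cardinality at most $k$. The $k$-TJ (token jumping) reconfiguration graph of $G$ for $X$ has as vertices the $X$-sets of $G$ of size exactly $k$, with two such sets $R_1,R_2$ adjacent iff $R_2$ is obtained from $R_1$ by exchanging exactly one vertex (i.e. $R_2=(R_1\setminus\{a\})\cup\{b\}$ with $a\in R_1$, $b\notin R_1$). -}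

module Defs where

open import Data.Nat using (ℕ; NonZero; suc; _≤_)
open import Data.Bool using (Bool; false)
open import Data.Fin using (Fin)
open import Data.Fin.Subset using (Subset; _∈_; _∉_; _⊆_; _∪_; _─_; _-_; ⁅_⁆; ∣_∣)
open import Data.Product using (Σ; ∃; ∃-syntax; _×_)
open import Function.Bundles using (_↔_; Inverse; _⇔_)
open import Relation.Binary.PropositionalEquality using (_≡_)
open import Relation.Binary.Construct.Closure.ReflexiveTransitive using (Star)

record Graph : Set where
  field
    order    : ℕ
    nonempty : NonZero order
    adj      : Fin order → Fin order → Bool
    adj-sym  : ∀ u v → adj u v ≡ adj v u
    adj-irr  : ∀ v → adj v v ≡ false
open Graph public

VSet : Graph → Set
VSet G = Subset (order G)

record Iso (G H : Graph) : Set where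
  field
    bij      : Fin (order G) ↔ Fin (order H)
    pres-adj : ∀ u v → adj G u v ≡ adj H (Inverse.to bij u) (Inverse.to bij v)

record VertexSetProperty : Set₁ where
  field
    IsXSet    : (G : Graph) → VSet G → Set
    iso-invar : ∀ (G H : Graph) (φ : Iso G H) (S : VSet G) (S' : VSet H) →
                (∀ v → (v ∈ S) ⇔ (Inverse.to (Iso.bij φ) v ∈ S')) →
                (IsXSet G S ⇔ IsXSet H S')
open VertexSetProperty public

Cohesive : VertexSetProperty → Set
Cohesive X = ∀ (G : Graph) → ∃[ S ] IsXSet X G S

record SuperXSetParameter : Set₁ where
  field
    prop     : VertexSetProperty
    cohesive : Cohesive prop
    superset : ∀ (G : Graph) (S S' : VSet G) → IsXSet prop G S → S ⊆ S' → IsXSet prop G S'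
open SuperXSetParameter public

_⊖_ : ∀ {n} → Subset n → Subset n → Subset n
A ⊖ B = (A ─ B) ∪ (B ─ A)

-- Edge relation of 𝔛_k(G): both endpoints X-sets of cardinality ≤ k, symmetric difference of size 1.
TARₖ-adj : (X : SuperXSetParameter) (G : Graph) (k : ℕ) → VSet G → VSet G → Set
TARₖ-adj X G k S₁ S₂ =
  (IsXSet (prop X) G S₁ × ∣ S₁ ∣ ≤ k) ×
  (IsXSet (prop X) G S₂ × ∣ S₂ ∣ ≤ k) ×
  ∣ S₁ ⊖ S₂ ∣ ≡ 1

TJₖ-adj : (X : SuperXSetParameter) (G : Graph) (k : ℕ) → VSet G → VSet G → Set
TJₖ-adj X G k R₁ R₂ =
  (IsXSet (prop X) G R₁ × ∣ R₁ ∣ ≡ k) ×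
  (IsXSet (prop X) G R₂ × ∣ R₂ ∣ ≡ k) ×
  (∃[ a ] ∃[ b ] (a ∈ R₁ × b ∉ R₁ × R₂ ≡ (R₁ - a) ∪ ⁅ b ⁆))

-- Paths (walks) between two vertices of a graph given by its edge relation.
-- (A walk exists iff a path exists.)
TARₖ-path : (X : SuperXSetParameter) (G : Graph) (k : ℕ) → VSet G → VSet G → Set
TARₖ-path X G k = Star (TARₖ-adj X G k)

TJₖ-path : (X : SuperXSetParameter) (G : Graph) (k : ℕ) → VSet G → VSet G → Set
TJₖ-path X G k = Star (TJₖ-adj X G k)

module Submission where

-- A TJ move R → (R ∖ {a}) ∪ {b} is simulated in 𝔛_{k+1} by first adding b and then
-- removing a; the intermediate set R ∪ {b} is an X-set because X is closed under supersets.
-- Conversely, walk along a path T₀ = S₁, T₁, … in 𝔛_{k+1} while keeping a token set R of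
-- size k that is TJ-reachable from S₁ and comparable (⊆ or ⊇) with the current Tᵢ. Each
-- addition or removal of one vertex is absorbed by at most one TJ move: when Tᵢ ⊂ R we
-- exchange a vertex of R ∖ Tᵢ for the added one (the result contains Tᵢ₊₁, so is an X-set);
-- when R ⊂ Tᵢ and a vertex of R is removed, Tᵢ has k + 1 elements and we exchange it for
-- the vertex of Tᵢ ∖ R, which yields Tᵢ₊₁ itself. At the end R is comparable with S₂ and
-- of the same size, hence equal to it.

open import Defs
open import Data.Nat using (ℕ; suc; _≤_; s≤s⁻¹)
open import Data.Nat.Properties using (≤-reflexive; ≤-trans; <-irrefl; <-≤-trans; suc-injective)
open import Data.Fin using (Fin; zero; suc)
open import Data.Fin.Properties using (¬∀⟶∃¬)
open import Data.Fin.Subset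
open import Data.Fin.Subset.Properties
open import Data.Bool using (true; false)
open import Data.Vec using ([]; _∷_; here; there)
open import Data.Product using (_×_; _,_; ∃-syntax)
open import Data.Sum using (_⊎_; inj₁; inj₂; [_,_])
import Data.Sum as Sum
import Data.Product as Product
open import Function using (id)
open import Function.Bundles using (_⇔_; mk⇔)
open import Relation.Nullary using (yes; no; contradiction)
open import Relation.Nullary.Decidable using (decidable-stable; _→-dec_)
open import Relation.Binary.PropositionalEquality using (_≡_; _≢_; refl; sym; trans; cong; subst)
open import Relation.Binary.Construct.Closure.ReflexiveTransitive using (ε; _◅_; _◅◅_; _⋆; gfoldl)

private variable
  n : ℕ
  i j a b : Fin n
  p p′ q r : Subset n

⊆⇒≡⊎⊂ : p ⊆ q → p ≡ q ⊎ p ⊂ q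
⊆⇒≡⊎⊂ {n} {p} {q} p⊆q with q ⊆? p
... | yes q⊆p = inj₁ (⊆-antisym p⊆q q⊆p)
... | no q⊈p with ¬∀⟶∃¬ n (λ x → x ∈ q → x ∈ p) (λ x → x ∈? q →-dec x ∈? p) (λ q⊆p → q⊈p (q⊆p _))
...   | x , x∈q⇏x∈p = inj₂ (p⊆q , x , x∈q , λ x∈p → x∈q⇏x∈p (λ _ → x∈p))
  where
  x∈q : x ∈ q
  x∈q = decidable-stable (x ∈? q) (λ x∉q → x∈q⇏x∈p (λ x∈q → contradiction x∈q x∉q))

⊆∧∣≥∣⇒≡ : p ⊆ q → ∣ q ∣ ≤ ∣ p ∣ → p ≡ q
⊆∧∣≥∣⇒≡ p⊆q ∣q∣≤∣p∣ with ⊆⇒≡⊎⊂ p⊆q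
... | inj₁ p≡q = p≡q
... | inj₂ p⊂q = contradiction (<-≤-trans (p⊂q⇒∣p∣<∣q∣ p⊂q) ∣q∣≤∣p∣) (<-irrefl refl)

-- Insert i p q : i ∉ p and q = p ∪ ⁅ i ⁆.
data Insert : Fin n → Subset n → Subset n → Set where
  insert-here  : Insert zero (false ∷ p) (true ∷ p)
  insert-there : ∀ {s} → Insert i p q → Insert (suc i) (s ∷ p) (s ∷ q)

insert-∉ : Insert i p q → i ∉ p
insert-∉ (insert-there ins) (there i∈p) = insert-∉ ins i∈p

insert-⊆ : Insert i p q → p ⊆ q
insert-⊆ insert-here        (there x∈p) = there x∈p
insert-⊆ (insert-there ins) here        = here
insert-⊆ (insert-there ins) (there x∈p) = there (insert-⊆ ins x∈p)

insert-∈⁻ : Insert i p q → j ∈ q → j ≡ i ⊎ j ∈ p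
insert-∈⁻ insert-here        here        = inj₁ refl
insert-∈⁻ insert-here        (there j∈q) = inj₂ (there j∈q)
insert-∈⁻ (insert-there ins) here        = inj₂ here
insert-∈⁻ (insert-there ins) (there j∈q) with insert-∈⁻ ins j∈q
... | inj₁ refl = inj₁ refl
... | inj₂ j∈p  = inj₂ (there j∈p)

insert-∣∣ : Insert i p q → ∣ q ∣ ≡ suc ∣ p ∣
insert-∣∣ insert-here                   = refl
insert-∣∣ (insert-there {s = true} ins)  = cong suc (insert-∣∣ ins)
insert-∣∣ (insert-there {s = false} ins) = insert-∣∣ ins

insert-∪⁅⁆ : i ∉ p → Insert i p (p ∪ ⁅ i ⁆)
insert-∪⁅⁆ {i = zero}  {p = true ∷ p}  i∉p = contradiction here i∉p
insert-∪⁅⁆ {i = zero}  {p = false ∷ p} i∉p =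
  subst (λ r → Insert zero (false ∷ p) (true ∷ r)) (sym (∪-identityʳ p)) insert-here
insert-∪⁅⁆ {i = suc i} {p = true ∷ p}  i∉p = insert-there (insert-∪⁅⁆ (λ i∈p → i∉p (there i∈p)))
insert-∪⁅⁆ {i = suc i} {p = false ∷ p} i∉p = insert-there (insert-∪⁅⁆ (λ i∈p → i∉p (there i∈p)))

insert-- : i ∈ q → Insert i (q - i) q
insert-- {i = zero}  {q = true ∷ q} here =
  subst (λ r → Insert zero (false ∷ r) (true ∷ q)) (sym (p─⊥≡p q)) insert-here
insert-- {i = suc i} {q = s ∷ q} (there i∈q) = insert-there (insert-- i∈q)

insert-diamond : Insert a p q → Insert b p r → a ≢ b → ∃[ s ] (Insert b q s × Insert a r s)
insert-diamond insert-here        insert-here        a≢b = contradiction refl a≢b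
insert-diamond insert-here        (insert-there ins) a≢b = _ , insert-there ins , insert-here
insert-diamond (insert-there ins) insert-here        a≢b = _ , insert-here , insert-there ins
insert-diamond (insert-there ins) (insert-there ins′) a≢b
  with insert-diamond ins ins′ (λ a≡b → a≢b (cong suc a≡b))
... | _ , ins₁ , ins₂ = _ , insert-there ins₁ , insert-there ins₂

∣[p-i]∪⁅j⁆∣≡∣p∣ : i ∈ p → j ∉ p → ∣ (p - i) ∪ ⁅ j ⁆ ∣ ≡ ∣ p ∣
∣[p-i]∪⁅j⁆∣≡∣p∣ {i = i} {p = p} i∈p j∉p =
  trans (insert-∣∣ (insert-∪⁅⁆ (λ j∈p-i → j∉p (p─q⊆p p ⁅ i ⁆ j∈p-i)))) (sym (insert-∣∣ (insert-- i∈p)))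

insert-⊆-swap : Insert i p p′ → p ⊆ q → a ∉ p → p′ ⊆ (q - a) ∪ ⁅ i ⁆
insert-⊆-swap ins p⊆q a∉p x∈p′ with insert-∈⁻ ins x∈p′
... | inj₁ refl = x∈p∪q⁺ (inj₂ (x∈⁅x⁆ _))
... | inj₂ x∈p  = x∈p∪q⁺ (inj₁ (x∈p∧x≢y⇒x∈p-y (p⊆q x∈p) (λ { refl → a∉p x∈p })))

swap-⊆-insert : Insert i p′ p → q ⊆ p → i ∈ q → j ∈ p → j ∉ q → (q - i) ∪ ⁅ j ⁆ ⊆ p′
swap-⊆-insert {i = i} {q = q} {j = j} ins q⊆p i∈q j∈p j∉q x∈ with x∈p∪q⁻ (q - i) ⁅ j ⁆ x∈
... | inj₁ x∈q-i with insert-∈⁻ ins (q⊆p (p─q⊆p q ⁅ i ⁆ x∈q-i))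
...   | inj₁ refl = contradiction x∈q-i (insert-∉ (insert-- i∈q))
...   | inj₂ x∈p′ = x∈p′
swap-⊆-insert {i = i} {q = q} {j = j} ins q⊆p i∈q j∈p j∉q x∈ | inj₂ x∈⁅j⁆
  with x∈⁅y⁆⇒x≡y j x∈⁅j⁆ | insert-∈⁻ ins j∈p
... | refl | inj₁ refl = contradiction i∈q j∉q
... | refl | inj₂ j∈p′ = j∈p′

⊖-comm : (p q : Subset n) → p ⊖ q ≡ q ⊖ p
⊖-comm p q = ∪-comm (p ─ q) (q ─ p)

∣p⊖p∣≡0 : (p : Subset n) → ∣ p ⊖ p ∣ ≡ 0
∣p⊖p∣≡0 []          = refl
∣p⊖p∣≡0 (true ∷ p)  = ∣p⊖p∣≡0 p
∣p⊖p∣≡0 (false ∷ p) = ∣p⊖p∣≡0 p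

∣p⊖q∣≡0⇒p≡q : (p q : Subset n) → ∣ p ⊖ q ∣ ≡ 0 → p ≡ q
∣p⊖q∣≡0⇒p≡q []          []          _ = refl
∣p⊖q∣≡0⇒p≡q (true ∷ p)  (true ∷ q)  e = cong (true ∷_) (∣p⊖q∣≡0⇒p≡q p q e)
∣p⊖q∣≡0⇒p≡q (false ∷ p) (false ∷ q) e = cong (false ∷_) (∣p⊖q∣≡0⇒p≡q p q e)

insert⇒∣⊖∣≡1 : Insert i p q → ∣ p ⊖ q ∣ ≡ 1
insert⇒∣⊖∣≡1 {p = false ∷ p} insert-here     = cong suc (∣p⊖p∣≡0 p)
insert⇒∣⊖∣≡1 (insert-there {s = true} ins)  = insert⇒∣⊖∣≡1 ins
insert⇒∣⊖∣≡1 (insert-there {s = false} ins) = insert⇒∣⊖∣≡1 ins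

∣⊖∣≡1⇒insert : (p q : Subset n) → ∣ p ⊖ q ∣ ≡ 1 → ∃[ i ] (Insert i p q ⊎ Insert i q p)
∣⊖∣≡1⇒insert []          []          ()
∣⊖∣≡1⇒insert (true ∷ p) (false ∷ q) e with ∣p⊖q∣≡0⇒p≡q p q (suc-injective e)
... | refl = zero , inj₂ insert-here
∣⊖∣≡1⇒insert (false ∷ p) (true ∷ q) e with ∣p⊖q∣≡0⇒p≡q p q (suc-injective e)
... | refl = zero , inj₁ insert-here
∣⊖∣≡1⇒insert (true ∷ p)  (true ∷ q)  e = Product.map suc (Sum.map insert-there insert-there) (∣⊖∣≡1⇒insert p q e)
∣⊖∣≡1⇒insert (false ∷ p) (false ∷ q) e = Product.map suc (Sum.map insert-there insert-there) (∣⊖∣≡1⇒insert p q e)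

module _ (X : SuperXSetParameter) (G : Graph) where

  IsX : VSet G → Set
  IsX = IsXSet (prop X) G

  TJVertex : ℕ → VSet G → Set
  TJVertex k R = IsX R × ∣ R ∣ ≡ k

  tar-adj-insert : ∀ {m T T′} {i : Fin (order G)} → Insert i T T′ → IsX T → ∣ T′ ∣ ≤ m →
                   TARₖ-adj X G m T T′
  tar-adj-insert {T = T} {T′} ins xT ∣T′∣≤m =
    (xT , ≤-trans (p⊆q⇒∣p∣≤∣q∣ (insert-⊆ ins)) ∣T′∣≤m) ,
    (superset X G T T′ xT (insert-⊆ ins) , ∣T′∣≤m) ,
    insert⇒∣⊖∣≡1 ins

  tar-adj-sym : ∀ {m T T′} → TARₖ-adj X G m T T′ → TARₖ-adj X G m T′ T
  tar-adj-sym {T = T} {T′} (vT , vT′ , d) = vT′ , vT , subst (λ D → ∣ D ∣ ≡ 1) (⊖-comm T T′) d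

  tj-adj⇒tar-path : ∀ {k R R′} → TJₖ-adj X G k R R′ → TARₖ-path X G (suc k) R R′
  tj-adj⇒tar-path {k} {R} ((xR , ∣R∣≡k) , (xR′ , ∣R′∣≡k) , a , b , a∈R , b∉R , refl)
    with insert-diamond (insert-- a∈R) (insert-∪⁅⁆ b∉R-a) a≢b
    where
    b∉R-a : b ∉ R - a
    b∉R-a b∈R-a = b∉R (p─q⊆p R ⁅ a ⁆ b∈R-a)
    a≢b : a ≢ b
    a≢b refl = b∉R a∈R
  ... | U , R+b , R′+a =
    tar-adj-insert R+b xR ∣U∣≤ ◅ tar-adj-sym (tar-adj-insert R′+a xR′ ∣U∣≤) ◅ ε
    where
    ∣U∣≤ : ∣ U ∣ ≤ suc k
    ∣U∣≤ = ≤-reflexive (trans (insert-∣∣ R+b) (cong suc ∣R∣≡k))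

  tj-path⇒tar-path : ∀ {k S₁ S₂} → TJₖ-path X G k S₁ S₂ → TARₖ-path X G (suc k) S₁ S₂
  tj-path⇒tar-path = tj-adj⇒tar-path ⋆

  Comparable : VSet G → VSet G → Set
  Comparable T R = T ⊆ R ⊎ R ⊆ T

  comparable-∣≡∣⇒≡ : ∀ {T R} → Comparable T R → ∣ T ∣ ≡ ∣ R ∣ → T ≡ R
  comparable-∣≡∣⇒≡ (inj₁ T⊆R) e = ⊆∧∣≥∣⇒≡ T⊆R (≤-reflexive (sym e))
  comparable-∣≡∣⇒≡ (inj₂ R⊆T) e = sym (⊆∧∣≥∣⇒≡ R⊆T (≤-reflexive e))

  record Shadow (k : ℕ) (S T : VSet G) : Set where
    constructor shadow
    field
      {R}      : VSet G
      vertex   : TJVertex k R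
      reach    : TJₖ-path X G k S R
      compares : Comparable T R

  module _ {k : ℕ} where

    shadow-swap : ∀ {R T′} {a b : Fin (order G)} → TJVertex k R → a ∈ R → b ∉ R →
                  IsX ((R - a) ∪ ⁅ b ⁆) → Comparable T′ ((R - a) ∪ ⁅ b ⁆) → Shadow k R T′
    shadow-swap vR@(_ , ∣R∣≡k) a∈R b∉R xR′ c = shadow vR′ ((vR , vR′ , _ , _ , a∈R , b∉R , refl) ◅ ε) c
      where vR′ = xR′ , trans (∣[p-i]∪⁅j⁆∣≡∣p∣ a∈R b∉R) ∣R∣≡k

    grow-step : ∀ {T T′ R} {i : Fin (order G)} → Insert i T T′ → IsX T′ →
                TJVertex k R → Comparable T R → Shadow k R T′
    grow-step ins _ vR (inj₂ R⊆T) = shadow vR ε (inj₂ (⊆-trans R⊆T (insert-⊆ ins)))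
    grow-step {R = R} {i} ins xT′ vR (inj₁ T⊆R) with i ∈? R
    ... | yes i∈R = shadow vR ε (inj₁ λ x∈T′ → [ (λ { refl → i∈R }) , T⊆R ] (insert-∈⁻ ins x∈T′))
    ... | no i∉R with ⊆⇒≡⊎⊂ T⊆R
    ...   | inj₁ refl = shadow vR ε (inj₂ (insert-⊆ ins))
    ...   | inj₂ (_ , a , a∈R , a∉T) =
      shadow-swap vR a∈R i∉R (superset X G _ _ xT′ T′⊆R′) (inj₁ T′⊆R′)
      where T′⊆R′ = insert-⊆-swap ins T⊆R a∉T

    shrink-step : ∀ {T T′ R} {i : Fin (order G)} → Insert i T′ T → ∣ T ∣ ≤ suc k → IsX T′ →
                  TJVertex k R → Comparable T R → Shadow k R T′
    shrink-step ins _ _ vR (inj₁ T⊆R) = shadow vR ε (inj₁ (⊆-trans (insert-⊆ ins) T⊆R))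
    shrink-step {R = R} {i} ins ∣T∣≤1+k xT′ vR@(_ , ∣R∣≡k) (inj₂ R⊆T) with i ∈? R
    ... | no i∉R =
      shadow vR ε (inj₂ λ x∈R → [ (λ { refl → contradiction x∈R i∉R }) , id ] (insert-∈⁻ ins (R⊆T x∈R)))
    ... | yes i∈R with ⊆⇒≡⊎⊂ R⊆T
    ...   | inj₁ refl = shadow vR ε (inj₁ (insert-⊆ ins))
    ...   | inj₂ (_ , u , u∈T , u∉R) =
      shadow-swap vR i∈R u∉R (subst IsX (sym R′≡T′) xT′) (inj₂ R′⊆T′)
      where
      R′⊆T′ = swap-⊆-insert ins R⊆T i∈R u∈T u∉R
      ∣T′∣≤k = s≤s⁻¹ (subst (_≤ suc k) (insert-∣∣ ins) ∣T∣≤1+k)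
      ∣R′∣≡k = trans (∣[p-i]∪⁅j⁆∣≡∣p∣ i∈R u∉R) ∣R∣≡k
      R′≡T′ = ⊆∧∣≥∣⇒≡ R′⊆T′ (≤-trans ∣T′∣≤k (≤-reflexive (sym ∣R′∣≡k)))

    ◅◅-shadow : ∀ {S R T} → TJₖ-path X G k S R → Shadow k R T → Shadow k S T
    ◅◅-shadow S⇝R (shadow vR′ R⇝R′ c) = shadow vR′ (S⇝R ◅◅ R⇝R′) c

    tar-adj-step : ∀ {S T T′} → Shadow k S T → TARₖ-adj X G (suc k) T T′ → Shadow k S T′
    tar-adj-step {T = T} {T′} (shadow vR S⇝R c) ((_ , ∣T∣≤1+k) , (xT′ , _) , d) with ∣⊖∣≡1⇒insert T T′ d
    ... | _ , inj₁ ins = ◅◅-shadow S⇝R (grow-step ins xT′ vR c)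
    ... | _ , inj₂ ins = ◅◅-shadow S⇝R (shrink-step ins ∣T∣≤1+k xT′ vR c)

    tar-path⇒tj-path : ∀ {S₁ S₂} → TJVertex k S₁ → ∣ S₂ ∣ ≡ k →
                       TARₖ-path X G (suc k) S₁ S₂ → TJₖ-path X G k S₁ S₂
    tar-path⇒tj-path v₁ ∣S₂∣≡k path
      with gfoldl id (Shadow k) tar-adj-step (shadow v₁ ε (inj₁ ⊆-refl)) path
    ... | shadow (_ , ∣R∣≡k) S₁⇝R c =
      subst (TJₖ-path X G k _) (sym (comparable-∣≡∣⇒≡ c (trans ∣S₂∣≡k (sym ∣R∣≡k)))) S₁⇝R

proposition2p44 : (X : SuperXSetParameter) (G : Graph) (k : ℕ) (S₁ S₂ : VSet G) →
    IsXSet (prop X) G S₁ → IsXSet (prop X) G S₂ → ∣ S₁ ∣ ≡ k → ∣ S₂ ∣ ≡ k →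
    (TJₖ-path X G k S₁ S₂ ⇔ TARₖ-path X G (suc k) S₁ S₂)
proposition2p44 X G k S₁ S₂ xS₁ _ ∣S₁∣≡k ∣S₂∣≡k =
  mk⇔ (tj-path⇒tar-path X G) (tar-path⇒tj-path X G (xS₁ , ∣S₁∣≡k) ∣S₂∣≡k)
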